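{- Let $p$ be a prime, let $m>n>0$ be integers and let $a\in\mathbb{F}_p^*$. If the polynomial $x^m+ax^n$ permutes the prime field $\mathbb{F}_p$, then $p-1\le (m-1)\cdot\max\bigl(n,\gcd(m-n,p-1)\bigr)$.
   Context: A polynomial $f\in\mathbb{F}_q[x]$ is said to permute $\mathbb{F}_q$ (be a permutation polynomial) if the map $\alpha\mapsto f(\alpha)$ is a bijection $\mathbb{F}_q\to\mathbb{F}_q$. -}

module Defs where

open import Data.Nat.Base using (ℕ; _+_; _*_; _^_; NonZero)
open import Data.Nat.DivMod using (_mod_)
open import Data.Fin.Base using (Fin; toℕ)
open import Function.Definitions using (Bijective)
open import Relation.Binary.PropositionalEquality using (_≡_)

-- The prime field F_p is modelled as Fin p = {0,…,p-1} with arithmetic mod p.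
-- binomMap p m n a : F_p → F_p is the evaluation map x ↦ x^m + a·x^n (mod p).
binomMap : (p : ℕ) .{{_ : NonZero p}} → (m n a : ℕ) → Fin p → Fin p
binomMap p m n a x = (toℕ x ^ m + a * toℕ x ^ n) mod p

Permutes : (p : ℕ) .{{_ : NonZero p}} → (m n a : ℕ) → Set
Permutes p m n a = Bijective {A = Fin p} {B = Fin p} _≡_ _≡_ (binomMap p m n a)

module Submission where

open import Defs
open import Data.Nat.Base using (ℕ; _≤_; _<_; _*_; _∸_; _⊔_; NonZero)
open import Data.Nat.GCD using (gcd)
open import Data.Nat.Primality using (Prime)

-- Write q = p - 1, s = m - n and P(e) = Σ_{x<p} x^e.  We prove the stronger
-- bound q ≤ (m - 1)·gcd(s, q) by a power-sum (Hermite criterion) argument.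
--  * Power sums: by Fermat's little theorem and the recursion
--    Σ_{k≤r} C(r+1,k)·P(k) = p^(r+1), P(e) ≡ 0 (mod p) when q ∤ e, while
--    P(e) ≡ q ≡ -1 when e is a positive multiple of q.
--  * Permutation: P(t) = Σ_x f(x)^t, and the binomial theorem gives
--    P(t) ≡ Σ_{l≤t} C(t,l)·a^(t-l)·P(n t + s l)  (mod p).
--  * Combinatorics: if (m - 1)·gcd(s, q) < q, there is 0 < t < q such that
--    q ∣ n t + s l for exactly one l ≤ t (descent on a representation of a
--    multiple of q as n·i + m·j).
--  For that t the left side vanishes, the right side is -C(t,l)·a^(t-l) ≢ 0.
-- The file develops finite sums, congruences mod p, power sums over a prime
-- field, the combinatorial lemma, and finally the theorem.

open import Data.Nat.Base
open import Data.Nat.Properties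
open import Data.Nat.DivMod
open import Data.Nat.Divisibility
open import Data.Nat.GCD using (gcd[m,n]≢0)
open import Data.Nat.LCM using (lcm; lcm-least; gcd*lcm)
open import Data.Nat.Primality using (euclidsLemma; prime⇒nonTrivial; ¬prime[0])
open import Data.Nat.Combinatorics using (_C_; nCk≡n!/k![n-k]!; k![n∸k]!∣n!; nCn≡1; nCk≡nC[n∸k]; nC1≡n)
open import Data.Nat.Induction using (<-wellFounded)
open import Data.Nat.Tactic.RingSolver using (solve-∀)
open import Data.Fin.Base using (Fin; toℕ; fromℕ<)
open import Data.Fin.Properties using (toℕ<n; toℕ-fromℕ<; any?)
open import Data.Fin.Permutation using (permutation)
open import Data.Product.Base using (Σ; _×_; _,_; proj₁; proj₂)
open import Data.Sum.Base using (_⊎_; inj₁; inj₂; [_,_]′)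
open import Data.Empty using (⊥; ⊥-elim)
open import Function.Base using (_∘_; id)
open import Function.Definitions using (Bijective)
open import Induction.WellFounded using (Acc; acc)
open import Level using (0ℓ)
open import Relation.Nullary using (¬_; yes; no)
open import Relation.Binary.Bundles using (Setoid)
open import Relation.Binary.Definitions using (tri<; tri≈; tri>)
open import Relation.Binary.PropositionalEquality
import Relation.Binary.Reasoning.Setoid as SetoidReasoning
open import Algebra.Properties.CommutativeSemigroup +-commutativeSemigroup using () renaming (interchange to +-interchange)
open import Algebra.Properties.CommutativeSemigroup *-commutativeSemigroup using (x∙yz≈y∙xz) renaming (interchange to *-interchange)
import Algebra.Properties.Semiring.Sum as SemiringSum
import Algebra.Properties.CommutativeSemiring.Binomial as Binomial
import Algebra.Definitions.RawMonoid as RawMonoidDefs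
import Algebra.Definitions.RawSemiring as RawSemiringDefs

module ℕ-Sum = SemiringSum +-*-semiring

Σ< : ℕ → (ℕ → ℕ) → ℕ
Σ< zero    h = 0
Σ< (suc n) h = h 0 + Σ< n (h ∘ suc)

Σ<-as-sum : ∀ n h → Σ< n h ≡ ℕ-Sum.sum (λ (i : Fin n) → h (toℕ i))
Σ<-as-sum zero    h = refl
Σ<-as-sum (suc n) h = cong (h 0 +_) (Σ<-as-sum n (h ∘ suc))

Σ<-cong : ∀ n {h g : ℕ → ℕ} → (∀ x → x < n → h x ≡ g x) → Σ< n h ≡ Σ< n g
Σ<-cong zero    e = refl
Σ<-cong (suc n) e = cong₂ _+_ (e 0 z<s) (Σ<-cong n (λ x x<n → e (suc x) (s<s x<n)))

Σ<-last : ∀ n h → Σ< (suc n) h ≡ Σ< n h + h n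
Σ<-last zero    h = +-comm (h 0) 0
Σ<-last (suc n) h = trans (cong (h 0 +_) (Σ<-last n (h ∘ suc))) (sym (+-assoc (h 0) _ _))

Σ<-distrib-+ : ∀ n h g → Σ< n (λ x → h x + g x) ≡ Σ< n h + Σ< n g
Σ<-distrib-+ zero    h g = refl
Σ<-distrib-+ (suc n) h g =
  trans (cong (h 0 + g 0 +_) (Σ<-distrib-+ n (h ∘ suc) (g ∘ suc))) (+-interchange (h 0) (g 0) _ _)

Σ<-distribˡ-* : ∀ n c h → Σ< n (λ x → c * h x) ≡ c * Σ< n h
Σ<-distribˡ-* zero    c h = sym (*-zeroʳ c)
Σ<-distribˡ-* (suc n) c h = trans (cong (c * h 0 +_) (Σ<-distribˡ-* n c (h ∘ suc))) (sym (*-distribˡ-+ c (h 0) _))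

Σ<-zeros : ∀ n → Σ< n (λ _ → 0) ≡ 0
Σ<-zeros zero    = refl
Σ<-zeros (suc n) = Σ<-zeros n

Σ<-comm : ∀ n k (h : ℕ → ℕ → ℕ) → Σ< n (λ x → Σ< k (h x)) ≡ Σ< k (λ y → Σ< n (λ x → h x y))
Σ<-comm zero    k h = sym (Σ<-zeros k)
Σ<-comm (suc n) k h =
  trans (cong (Σ< k (h 0) +_) (Σ<-comm n k (h ∘ suc))) (sym (Σ<-distrib-+ k (h 0) _))

Σ<-ones : ∀ n → Σ< n (λ _ → 1) ≡ n
Σ<-ones zero    = refl
Σ<-ones (suc n) = cong suc (Σ<-ones n)

Σ<-bijection : ∀ {N} (f : Fin N → Fin N) → Bijective _≡_ _≡_ f →
               ∀ h → Σ< N h ≡ ℕ-Sum.sum (λ i → h (toℕ (f i)))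
Σ<-bijection {N} f (injective , surjective) h = trans (Σ<-as-sum N h) (ℕ-Sum.sum-permute (h ∘ toℕ) π)
  where
  π = permutation f (proj₁ ∘ surjective)
        (λ y → proj₂ (surjective y) refl)
        (λ x → injective (proj₂ (surjective (f x)) refl))

-- The library states the binomial theorem for an arbitrary commutative
-- semiring, with its own multiples and powers; on ℕ these agree with _*_, _^_.
binomial-theorem : ∀ n x y → (x + y) ^ n ≡ Σ< (suc n) (λ k → (n C k) * (x ^ k * y ^ (n ∸ k)))
binomial-theorem n x y = begin
  (x + y) ^ n                ≡⟨ semiring-^ (x + y) n ⟨
  RS._^_ (x + y) n           ≡⟨ B.theorem n x y ⟩
  B.binomialExpansion x y n  ≡⟨ ℕ-Sum.sum-cong-≗ {suc n} {B.binomialTerm x y n} term-agrees ⟩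
  ℕ-Sum.sum (λ (k : Fin (suc n)) → (n C toℕ k) * (x ^ toℕ k * y ^ (n ∸ toℕ k)))
                             ≡⟨ Σ<-as-sum (suc n) (λ k → (n C k) * (x ^ k * y ^ (n ∸ k))) ⟨
  Σ< (suc n) (λ k → (n C k) * (x ^ k * y ^ (n ∸ k))) ∎
  where
  open ≡-Reasoning
  module B = Binomial +-*-commutativeSemiring
  module RS = RawSemiringDefs +-*-rawSemiring
  semiring-× : ∀ k x → RawMonoidDefs._×_ +-0-rawMonoid k x ≡ k * x
  semiring-× zero    x = refl
  semiring-× (suc k) x = cong (x +_) (semiring-× k x)
  semiring-^ : ∀ x k → RS._^_ x k ≡ x ^ k
  semiring-^ x zero    = refl
  semiring-^ x (suc k) = cong (x *_) (semiring-^ x k)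
  term-agrees : ∀ k → B.binomialTerm x y n k ≡ (n C toℕ k) * (x ^ toℕ k * y ^ (n ∸ toℕ k))
  term-agrees k = trans (semiring-× (n C toℕ k) _)
    (cong ((n C toℕ k) *_) (cong₂ _*_ (semiring-^ x (toℕ k)) (semiring-^ y (n ∸ toℕ k))))

succ-power : ∀ r x → suc x ^ r ≡ Σ< (suc r) (λ k → (r C k) * x ^ k)
succ-power r x = trans (cong (_^ r) (+-comm 1 x))
  (trans (binomial-theorem r x 1)
    (Σ<-cong (suc r) (λ k _ → cong ((r C k) *_) (trans (cong (x ^ k *_) (^-zeroˡ (r ∸ k))) (*-identityʳ (x ^ k))))))

C*factorials : ∀ {n k} → k ≤ n → (n C k) * (k ! * (n ∸ k) !) ≡ n !
C*factorials {n} {k} k≤n = trans (cong (_* (k ! * (n ∸ k) !)) (nCk≡n!/k![n-k]! k≤n))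
                                 (m/n*n≡m {{k !* (n ∸ k) !≢0}} (k![n∸k]!∣n! k≤n))

C[1+n,n] : ∀ n → suc n C n ≡ suc n
C[1+n,n] n = trans (nCk≡nC[n∸k] (n≤1+n n)) (trans (cong (suc n C_) (m+n∸n≡m 1 n)) (nC1≡n (suc n)))

powerSum : ℕ → ℕ → ℕ
powerSum N e = Σ< N (_^ e)

-- Telescoping Σ_{x<N} ((x+1)^(r+1) - x^(r+1)) = N^(r+1), after expanding
-- (x+1)^(r+1) by the binomial theorem.
powerSum-recurrence : ∀ N r → Σ< (suc r) (λ k → (suc r C k) * powerSum N k) ≡ N ^ suc r
powerSum-recurrence N r = +-cancelʳ-≡ (powerSum N (suc r)) _ _ (begin
  Σ< (suc r) f + powerSum N (suc r)
    ≡⟨ cong (_+ powerSum N (suc r)) (trans (Σ<-comm N (suc r) (λ x k → (suc r C k) * x ^ k))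
                                          (Σ<-cong (suc r) (λ k _ → Σ<-distribˡ-* N (suc r C k) (_^ k)))) ⟨
  Σ< N (λ x → Σ< (suc r) (λ k → (suc r C k) * x ^ k)) + powerSum N (suc r)
    ≡⟨ Σ<-distrib-+ N _ (_^ suc r) ⟨
  Σ< N (λ x → Σ< (suc r) (λ k → (suc r C k) * x ^ k) + x ^ suc r)
    ≡⟨ Σ<-cong N (λ x _ → sym (expand x)) ⟩
  Σ< N (λ x → suc x ^ suc r)
    ≡⟨ Σ<-last N (_^ suc r) ⟩
  powerSum N (suc r) + N ^ suc r
    ≡⟨ +-comm (powerSum N (suc r)) _ ⟩
  N ^ suc r + powerSum N (suc r) ∎)
  where
  open ≡-Reasoning
  f : ℕ → ℕ
  f k = (suc r C k) * powerSum N k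
  expand : ∀ x → suc x ^ suc r ≡ Σ< (suc r) (λ k → (suc r C k) * x ^ k) + x ^ suc r
  expand x = trans (succ-power (suc r) x)
    (trans (Σ<-last (suc r) (λ k → (suc r C k) * x ^ k)) (cong (Σ< (suc r) (λ k → (suc r C k) * x ^ k) +_)
      (trans (cong (_* x ^ suc r) (nCn≡1 (suc r))) (+-identityʳ (x ^ suc r)))))

^-distribʳ-* : ∀ a b k → (a * b) ^ k ≡ a ^ k * b ^ k
^-distribʳ-* a b zero    = refl
^-distribʳ-* a b (suc k) = trans (cong (a * b *_) (^-distribʳ-* a b k)) (*-interchange a b (a ^ k) (b ^ k))

expand-powerSum : ∀ N n s a t →
  Σ< N (λ x → (x ^ (n + s) + a * x ^ n) ^ t)
    ≡ Σ< (suc t) (λ l → (t C l) * (a ^ (t ∸ l) * powerSum N (n * t + s * l)))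
expand-powerSum N n s a t = begin
  Σ< N (λ x → (x ^ (n + s) + a * x ^ n) ^ t)
    ≡⟨ Σ<-cong N (λ x _ → trans (binomial-theorem t _ _)
         (Σ<-cong (suc t) (λ l l<1+t → cong ((t C l) *_) (monomial x l (≤-pred l<1+t))))) ⟩
  Σ< N (λ x → Σ< (suc t) (λ l → (t C l) * (a ^ (t ∸ l) * x ^ (n * t + s * l))))
    ≡⟨ Σ<-comm N (suc t) (λ x l → (t C l) * (a ^ (t ∸ l) * x ^ (n * t + s * l))) ⟩
  Σ< (suc t) (λ l → Σ< N (λ x → (t C l) * (a ^ (t ∸ l) * x ^ (n * t + s * l))))
    ≡⟨ Σ<-cong (suc t) (λ l _ → trans (Σ<-distribˡ-* N (t C l) _)
         (cong ((t C l) *_) (Σ<-distribˡ-* N (a ^ (t ∸ l)) (_^ (n * t + s * l))))) ⟩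
  Σ< (suc t) (λ l → (t C l) * (a ^ (t ∸ l) * powerSum N (n * t + s * l))) ∎
  where
  open ≡-Reasoning
  exponent : ∀ l → l ≤ t → (n + s) * l + n * (t ∸ l) ≡ n * t + s * l
  exponent l l≤t = trans (rearrange n s l (t ∸ l)) (cong (λ u → n * u + s * l) (m∸n+n≡m l≤t))
    where
    rearrange : ∀ n s l d → (n + s) * l + n * d ≡ n * (d + l) + s * l
    rearrange = solve-∀
  monomial : ∀ x l → l ≤ t → (x ^ (n + s)) ^ l * (a * x ^ n) ^ (t ∸ l) ≡ a ^ (t ∸ l) * x ^ (n * t + s * l)
  monomial x l l≤t = begin
    (x ^ (n + s)) ^ l * (a * x ^ n) ^ (t ∸ l)
      ≡⟨ cong₂ _*_ (^-*-assoc x (n + s) l) (trans (^-distribʳ-* a (x ^ n) (t ∸ l)) (cong (a ^ (t ∸ l) *_) (^-*-assoc x n (t ∸ l)))) ⟩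
    x ^ ((n + s) * l) * (a ^ (t ∸ l) * x ^ (n * (t ∸ l)))
      ≡⟨ x∙yz≈y∙xz (x ^ ((n + s) * l)) (a ^ (t ∸ l)) _ ⟩
    a ^ (t ∸ l) * (x ^ ((n + s) * l) * x ^ (n * (t ∸ l)))
      ≡⟨ cong (a ^ (t ∸ l) *_) (^-distribˡ-+-* x ((n + s) * l) (n * (t ∸ l))) ⟨
    a ^ (t ∸ l) * x ^ ((n + s) * l + n * (t ∸ l))
      ≡⟨ cong (λ e → a ^ (t ∸ l) * x ^ e) (exponent l l≤t) ⟩
    a ^ (t ∸ l) * x ^ (n * t + s * l) ∎

-- If q ∣ s·d with s, d > 0 then q ≤ gcd(s,q)·d, as lcm(s,q) ∣ s·d.
divisor-bound : ∀ s q d → 0 < s → 0 < d → q ∣ s * d → q ≤ gcd s q * d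
divisor-bound s q d 0<s 0<d q∣sd = *-cancelˡ-≤ s {{>-nonZero 0<s}} (begin
  s * q                ≡⟨ gcd*lcm s q ⟨
  gcd s q * lcm s q    ≤⟨ *-monoʳ-≤ (gcd s q) (∣⇒≤ {{>-nonZero (*-mono-< 0<s 0<d)}} (lcm-least (m∣m*n {s} d) q∣sd)) ⟩
  gcd s q * (s * d)    ≡⟨ x∙yz≈y∙xz (gcd s q) s d ⟩
  s * (gcd s q * d)    ∎)
  where
  open ≤-Reasoning

record UniqueExponent (q n s : ℕ) : Set where
  field
    t j          : ℕ
    0<t          : 0 < t
    t<q          : t < q
    j≤t          : j ≤ t
    divides-at-j : q ∣ n * t + s * j
    unique       : ∀ l → l ≤ t → q ∣ n * t + s * l → l ≡ j

module ExponentSearch (q n s : ℕ) (0<n : 0 < n) (0<s : 0 < s) (small : (n + s ∸ 1) * gcd s q < q) where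

  m : ℕ
  m = n + s

  0<m : 0 < m
  0<m = ≤-trans 0<n (m≤m+n n s)

  instance
    m-nonZero : NonZero m
    m-nonZero = >-nonZero 0<m

  m≤q : m ≤ q
  m≤q = subst (_≤ q) (suc-pred m) (≤-<-trans (m≤m*n (m ∸ 1) (gcd s q) {{gcd-nonZero}}) small)
    where
    gcd-nonZero : NonZero (gcd s q)
    gcd-nonZero = ≢-nonZero (gcd[m,n]≢0 s q (inj₁ (>⇒≢ 0<s)))

  record Representation (k : ℕ) : Set where
    constructor representation
    field
      i j        : ℕ
      i<m        : i < m
      represents : n * i + m * j ≡ k * q

  normalise : ∀ {k} a l → n * a + m * l ≡ k * q → Representation k
  normalise a l eq = representation (a % m) (l + n * (a / m)) (m%n<n a m)
    (trans (rearrange n (a % m) (a / m) m l)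
      (trans (cong (λ u → n * u + m * l) (sym (m≡m%n+[m/n]*n a m))) eq))
    where
    rearrange : ∀ n r b m l → n * r + m * (l + n * b) ≡ n * (r + b * m) + m * l
    rearrange = solve-∀

  SmallerRepresentation : ℕ → Set
  SmallerRepresentation k = Σ ℕ λ k′ → k′ < k × 0 < k′ × Representation k′

  module Candidate (k : ℕ) (0<k : 0 < k) (k≤n : k ≤ n) (r : Representation k) where
    open Representation r

    t : ℕ
    t = i + j

    solves : n * t + s * j ≡ k * q
    solves = trans (rearrange n s i j) represents
      where
      rearrange : ∀ n s i j → n * (i + j) + s * j ≡ n * i + (n + s) * j
      rearrange = solve-∀

    0<kq : 0 < k * q
    0<kq = *-mono-< 0<k (≤-trans 0<m m≤q)

    0<t : 0 < t
    0<t = n≢0⇒n>0 λ t≡0 → <⇒≢ 0<kq (sym (trans (sym solves) (cong₂ _+_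
      (trans (cong (n *_) t≡0) (*-zeroʳ n)) (trans (cong (s *_) (m+n≡0⇒n≡0 i t≡0)) (*-zeroʳ s)))))

    -- If t ≥ q then n t ≥ n q ≥ k q forces j = 0, so t = i < m ≤ q.
    t<q : t < q
    t<q = ≰⇒> λ q≤t → <⇒≱ (subst (_< q) (sym (t≡i q≤t)) (<-≤-trans i<m m≤q)) q≤t
      where
      t≡i : q ≤ t → t ≡ i
      t≡i q≤t = trans (cong (i +_) j≡0) (+-identityʳ i)
        where
        sj≤0 : n * t + s * j ≤ n * t + 0
        sj≤0 = begin
          n * t + s * j ≡⟨ solves ⟩
          k * q         ≤⟨ *-monoˡ-≤ q k≤n ⟩
          n * q         ≤⟨ *-monoʳ-≤ n q≤t ⟩
          n * t         ≡⟨ +-identityʳ (n * t) ⟨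
          n * t + 0     ∎
          where open ≤-Reasoning
        j≡0 : j ≡ 0
        j≡0 = [ (λ s≡0 → ⊥-elim (>⇒≢ 0<s s≡0)) , id ]′
                (m*n≡0⇒m≡0∨n≡0 s (n≤0⇒n≡0 (+-cancelˡ-≤ (n * t) _ _ sj≤0)))

    j≤t : j ≤ t
    j≤t = m≤n+m j i

    -- A solution l > j is impossible: q ∣ s·(l - j) with 0 < l - j ≤ i < m
    -- would give q ≤ gcd(s,q)·(m - 1).
    no-solution-above : ∀ l → j < l → l ≤ t → ¬ q ∣ n * t + s * l
    no-solution-above l j<l l≤t q∣ntsl = <⇒≱ small (begin
      q                   ≤⟨ divisor-bound s q d 0<s (m<n⇒0<n∸m j<l) q∣sd ⟩
      gcd s q * d         ≤⟨ *-monoʳ-≤ (gcd s q) d≤m-1 ⟩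
      gcd s q * (m ∸ 1)   ≡⟨ *-comm (gcd s q) (m ∸ 1) ⟩
      (m ∸ 1) * gcd s q   ∎)
      where
      open ≤-Reasoning
      d : ℕ
      d = l ∸ j
      split : n * t + s * l ≡ k * q + s * d
      split = trans (cong (λ u → n * t + s * u) (sym (m+[n∸m]≡n (<⇒≤ j<l))))
                (trans (rearrange n s t j d) (cong (_+ s * d) solves))
        where
        rearrange : ∀ n s t j d → n * t + s * (j + d) ≡ (n * t + s * j) + s * d
        rearrange = solve-∀
      q∣sd : q ∣ s * d
      q∣sd = ∣m+n∣m⇒∣n (subst (q ∣_) split q∣ntsl) (n∣m*n k)
      d≤m-1 : d ≤ m ∸ 1
      d≤m-1 = ≤-trans (∸-monoˡ-≤ j l≤t) (≤-trans (≤-reflexive (m+n∸n≡m i j)) (∸-monoˡ-≤ 1 i<m))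

    solution-below : ∀ l → l < j → q ∣ n * t + s * l → SmallerRepresentation k
    solution-below l l<j (divides k′ eq) = k′ , k′<k , 0<k′ ,
      normalise (t ∸ l) l (trans (rearrange n s (t ∸ l) l) (trans (cong (λ u → n * u + s * l) (m∸n+n≡m l≤t)) eq))
      where
      l≤t : l ≤ t
      l≤t = ≤-trans (<⇒≤ l<j) j≤t
      k′<k : k′ < k
      k′<k = *-cancelʳ-< q k′ k (subst₂ _<_ eq solves (+-monoʳ-< (n * t) (*-monoʳ-< s {{>-nonZero 0<s}} l<j)))
      0<k′ : 0 < k′
      0<k′ = n≢0⇒n>0 λ { refl → <⇒≢ (≤-trans (*-mono-< 0<n 0<t) (m≤m+n (n * t) (s * l))) (sym eq) }
      rearrange : ∀ n s a l → n * a + (n + s) * l ≡ n * (a + l) + s * l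
      rearrange = solve-∀

    resolve : UniqueExponent q n s ⊎ SmallerRepresentation k
    resolve with any? (λ (l : Fin j) → q ∣? n * t + s * toℕ l)
    ... | yes (l , q∣) = inj₂ (solution-below (toℕ l) (toℕ<n l) q∣)
    ... | no none      = inj₁ (record
      { t = t ; j = j ; 0<t = 0<t ; t<q = t<q ; j≤t = j≤t
      ; divides-at-j = divides k solves ; unique = unique })
      where
      unique : ∀ l → l ≤ t → q ∣ n * t + s * l → l ≡ j
      unique l l≤t q∣ with <-cmp l j
      ... | tri< l<j _ _ = ⊥-elim (none (fromℕ< l<j , subst (λ u → q ∣ n * t + s * u) (sym (toℕ-fromℕ< l<j)) q∣))
      ... | tri≈ _ l≡j _ = l≡j
      ... | tri> _ _ j<l = ⊥-elim (no-solution-above l j<l l≤t q∣)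

  descend : ∀ k → Acc _<_ k → 0 < k → k ≤ n → Representation k → UniqueExponent q n s
  descend k (acc smaller) 0<k k≤n r with Candidate.resolve k 0<k k≤n r
  ... | inj₁ found                      = found
  ... | inj₂ (k′ , k′<k , 0<k′ , r′) = descend k′ (smaller k′<k) 0<k′ (≤-trans (<⇒≤ k′<k) k≤n) r′

  uniqueExponent : UniqueExponent q n s
  uniqueExponent = descend n (<-wellFounded n) 0<n ≤-refl
    (normalise q 0 (trans (cong (n * q +_) (*-zeroʳ m)) (+-identityʳ (n * q))))

module Congruence (p : ℕ) .{{_ : NonZero p}} where

  -- a ≈ b is congruence modulo p.  It is a record rather than a bare equation
  -- of residues so that a and b can be inferred from a proof.
  infix 4 _≈_
  record _≈_ (a b : ℕ) : Set where
    constructor mk≈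
    field same-residue : a % p ≡ b % p
  open _≈_

  ≈-refl : ∀ {a} → a ≈ a
  ≈-refl = mk≈ refl

  ≈-sym : ∀ {a b} → a ≈ b → b ≈ a
  ≈-sym (mk≈ e) = mk≈ (sym e)

  ≈-trans : ∀ {a b c} → a ≈ b → b ≈ c → a ≈ c
  ≈-trans (mk≈ e) (mk≈ f) = mk≈ (trans e f)

  ≡⇒≈ : ∀ {a b} → a ≡ b → a ≈ b
  ≡⇒≈ refl = ≈-refl

  ≈-setoid : Setoid 0ℓ 0ℓ
  ≈-setoid = record { Carrier = ℕ ; _≈_ = _≈_
                    ; isEquivalence = record { refl = ≈-refl ; sym = ≈-sym ; trans = ≈-trans } }

  module ≈-Reasoning = SetoidReasoning ≈-setoid

  +-cong : ∀ {a b c d} → a ≈ b → c ≈ d → a + c ≈ b + d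
  +-cong {a} {b} {c} {d} (mk≈ e) (mk≈ f) =
    mk≈ (trans (%-distribˡ-+ a c p) (trans (cong₂ (λ u v → (u + v) % p) e f) (sym (%-distribˡ-+ b d p))))

  *-cong : ∀ {a b c d} → a ≈ b → c ≈ d → a * c ≈ b * d
  *-cong {a} {b} {c} {d} (mk≈ e) (mk≈ f) =
    mk≈ (trans (%-distribˡ-* a c p) (trans (cong₂ (λ u v → (u * v) % p) e f) (sym (%-distribˡ-* b d p))))

  ^-cong : ∀ {a b} k → a ≈ b → a ^ k ≈ b ^ k
  ^-cong zero    e = ≈-refl
  ^-cong (suc k) e = *-cong e (^-cong k e)

  %-≈ : ∀ a → a % p ≈ a
  %-≈ a = mk≈ (m%n%n≡m%n a p)

  0%p≡0 : 0 % p ≡ 0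
  0%p≡0 = n∣m⇒m%n≡0 0 p (p ∣0)

  ∣⇒≈0 : ∀ {a} → p ∣ a → a ≈ 0
  ∣⇒≈0 {a} d = mk≈ (trans (n∣m⇒m%n≡0 a p d) (sym 0%p≡0))

  ≈0⇒∣ : ∀ {a} → a ≈ 0 → p ∣ a
  ≈0⇒∣ {a} (mk≈ e) = m%n≡0⇒n∣m a p (trans e 0%p≡0)

  ≈⇒∣∸ : ∀ {a b} → b ≤ a → a ≈ b → p ∣ a ∸ b
  ≈⇒∣∸ {a} {b} b≤a (mk≈ e) = divides (a / p ∸ b / p) (begin
    a ∸ b                                       ≡⟨ cong₂ _∸_ (m≡m%n+[m/n]*n a p) (m≡m%n+[m/n]*n b p) ⟩
    (a % p + a / p * p) ∸ (b % p + b / p * p)   ≡⟨ cong (λ u → (u + a / p * p) ∸ (b % p + b / p * p)) e ⟩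
    (b % p + a / p * p) ∸ (b % p + b / p * p)   ≡⟨ [m+n]∸[m+o]≡n∸o (b % p) (a / p * p) (b / p * p) ⟩
    a / p * p ∸ b / p * p                       ≡⟨ *-distribʳ-∸ p (a / p) (b / p) ⟨
    (a / p ∸ b / p) * p                         ∎)
    where open ≡-Reasoning

  ∣∸⇒≈ : ∀ {a b} → b ≤ a → p ∣ a ∸ b → a ≈ b
  ∣∸⇒≈ {a} {b} b≤a (divides c eq) = mk≈ (begin
    a % p             ≡⟨ cong (_% p) (m+[n∸m]≡n b≤a) ⟨
    (b + (a ∸ b)) % p ≡⟨ cong (λ u → (b + u) % p) eq ⟩
    (b + c * p) % p   ≡⟨ [m+kn]%n≡m%n b c p ⟩
    b % p             ∎)
    where open ≡-Reasoning

  Σ<-cong-≈ : ∀ n {h g} → (∀ x → x < n → h x ≈ g x) → Σ< n h ≈ Σ< n g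
  Σ<-cong-≈ zero    e = ≈-refl
  Σ<-cong-≈ (suc n) e = +-cong (e 0 z<s) (Σ<-cong-≈ n (λ x x<n → e (suc x) (s<s x<n)))

  Σ<-∣ : ∀ n {h} → (∀ x → x < n → p ∣ h x) → p ∣ Σ< n h
  Σ<-∣ zero    e = p ∣0
  Σ<-∣ (suc n) e = ∣m∣n⇒∣m+n (e 0 z<s) (Σ<-∣ n (λ x x<n → e (suc x) (s<s x<n)))

  Σ<-single : ∀ N h j → j < N → (∀ l → l < N → l ≢ j → p ∣ h l) → Σ< N h ≈ h j
  Σ<-single (suc N) h zero    _ others =
    ≈-trans (+-cong {h 0} ≈-refl (∣⇒≈0 (Σ<-∣ N (λ x x<N → others (suc x) (s<s x<N) (λ ())))))
            (≡⇒≈ (+-identityʳ (h 0)))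
  Σ<-single (suc N) h (suc j) j<N others =
    +-cong {h 0} {0} (∣⇒≈0 (others 0 z<s (λ ())))
      (Σ<-single N (h ∘ suc) j (s<s⁻¹ j<N) (λ l l<N l≢j → others (suc l) (s<s l<N) (l≢j ∘ suc-injective)))

  permutation-powerSum : (g : ℕ → ℕ) → Bijective _≡_ _≡_ (λ (x : Fin p) → g (toℕ x) mod p) →
                         ∀ t → powerSum p t ≈ Σ< p (λ x → g x ^ t)
  permutation-powerSum g bijective t = begin
    powerSum p t                                  ≡⟨ Σ<-bijection {p} (λ x → g (toℕ x) mod p) bijective (_^ t) ⟩
    ℕ-Sum.sum (λ (i : Fin p) → toℕ (g (toℕ i) mod p) ^ t)
        ≡⟨ ℕ-Sum.sum-cong-≗ {p} {λ i → toℕ (g (toℕ i) mod p) ^ t} (λ i → cong (_^ t) (toℕ-mod (g (toℕ i)))) ⟩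
    ℕ-Sum.sum (λ (i : Fin p) → (g (toℕ i) % p) ^ t) ≡⟨ Σ<-as-sum p (λ x → (g x % p) ^ t) ⟨
    Σ< p (λ x → (g x % p) ^ t)                    ≈⟨ Σ<-cong-≈ p (λ x _ → ^-cong t (%-≈ (g x))) ⟩
    Σ< p (λ x → g x ^ t)                          ∎
    where
    open ≈-Reasoning
    toℕ-mod : ∀ x → toℕ (x mod p) ≡ x % p
    toℕ-mod x = toℕ-fromℕ< (m%n<n x p)

module PrimeField (q : ℕ) (p-prime : Prime (suc q)) where

  p : ℕ
  p = suc q

  open Congruence p

  0<q : 0 < q
  0<q = s<s⁻¹ (nonTrivial⇒n>1 p {{prime⇒nonTrivial p-prime}})

  instance
    q-nonZero : NonZero q
    q-nonZero = >-nonZero 0<q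

  ∤-small : ∀ {x} → 0 < x → x < p → ¬ p ∣ x
  ∤-small 0<x x<p d = <⇒≱ x<p (∣⇒≤ {{>-nonZero 0<x}} d)

  ∤-* : ∀ {a b} → ¬ p ∣ a → ¬ p ∣ b → ¬ p ∣ a * b
  ∤-* p∤a p∤b d = [ p∤a , p∤b ]′ (euclidsLemma _ _ p-prime d)

  ∤-^ : ∀ {a} k → ¬ p ∣ a → ¬ p ∣ a ^ k
  ∤-^ zero    p∤a = ∤-small z<s (s<s 0<q)
  ∤-^ (suc k) p∤a = ∤-* p∤a (∤-^ k p∤a)

  ∤-! : ∀ n → n < p → ¬ p ∣ n !
  ∤-! zero    _   = ∤-small z<s (s<s 0<q)
  ∤-! (suc n) n<p = ∤-* (∤-small z<s n<p) (∤-! n (<-trans (n<1+n n) n<p))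

  -- p ∣ C(p,k) for 0 < k < p, since p ∣ p! but p ∤ k!·(p-k)!.
  ∣-C : ∀ k → 0 < k → k < p → p ∣ p C k
  ∣-C k 0<k k<p =
    [ id , (λ d → ⊥-elim (∤-* (∤-! k k<p) (∤-! (p ∸ k) (∸-monoʳ-< 0<k (<⇒≤ k<p))) d)) ]′
      (euclidsLemma (p C k) _ p-prime (subst (p ∣_) (sym (C*factorials (<⇒≤ k<p))) (m∣m*n (q !))))

  -- p ∤ C(t,j) for j ≤ t < p, since C(t,j) divides t!.
  ∤-C : ∀ {t j} → j ≤ t → t < p → ¬ p ∣ t C j
  ∤-C {t} j≤t t<p d = ∤-! t t<p (subst (p ∣_) (C*factorials j≤t) (∣m⇒∣m*n _ d))

  -- Fermat's little theorem, by induction on x: (x + 1)^p ≡ x^p + 1.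
  fermat : ∀ x → x ^ p ≈ x
  fermat zero    = ≈-refl
  fermat (suc x) = begin
    suc x ^ p                   ≡⟨ trans (succ-power p x) (Σ<-last p h) ⟩
    1 + Σ< q (h ∘ suc) + h p    ≈⟨ +-cong (+-cong {1} ≈-refl (∣⇒≈0 middle)) (≡⇒≈ top) ⟩
    1 + 0 + x ^ p               ≈⟨ +-cong {1} ≈-refl (fermat x) ⟩
    suc x                       ∎
    where
    open ≈-Reasoning
    h : ℕ → ℕ
    h k = (p C k) * x ^ k
    middle : p ∣ Σ< q (h ∘ suc)
    middle = Σ<-∣ q (λ k k<q → ∣m⇒∣m*n _ (∣-C (suc k) z<s (s<s k<q)))
    top : h p ≡ x ^ p
    top = trans (cong (_* x ^ p) (nCn≡1 p)) (+-identityʳ (x ^ p))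

  power-shift : ∀ e x → 0 < e → x ^ (e + q) ≈ x ^ e
  power-shift (suc e) x _ = begin
    x ^ (suc e + q)   ≡⟨ cong (x ^_) (+-suc e q) ⟨
    x ^ (e + p)       ≡⟨ ^-distribˡ-+-* x e p ⟩
    x ^ e * x ^ p     ≈⟨ *-cong {x ^ e} ≈-refl (fermat x) ⟩
    x ^ e * x         ≡⟨ *-comm (x ^ e) x ⟩
    x ^ suc e         ∎
    where open ≈-Reasoning

  power-periodic : ∀ c e x → 0 < e → x ^ (e + c * q) ≈ x ^ e
  power-periodic zero    e x _   = ≡⇒≈ (cong (x ^_) (+-identityʳ e))
  power-periodic (suc c) e x 0<e = begin
    x ^ (e + (q + c * q))   ≡⟨ cong (x ^_) (rearrange e q c) ⟩
    x ^ (e + c * q + q)     ≈⟨ power-shift (e + c * q) x (≤-trans 0<e (m≤m+n e _)) ⟩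
    x ^ (e + c * q)         ≈⟨ power-periodic c e x 0<e ⟩
    x ^ e                   ∎
    where
    open ≈-Reasoning
    rearrange : ∀ e q c → e + (q + c * q) ≡ e + c * q + q
    rearrange = solve-∀

  -- Every unit satisfies x^q ≡ 1: cancel x from x·x^q ≡ x ≡ x·1.
  unit-power : ∀ x → 0 < x → x < p → x ^ q ≈ 1
  unit-power x@(suc _) 0<x x<p = ∣∸⇒≈ (m^n>0 x q) ([ (λ d → ⊥-elim (∤-small 0<x x<p d)) , id ]′ (euclidsLemma x _ p-prime p∣x[x^q∸1]))
    where
    p∣x[x^q∸1] : p ∣ x * (x ^ q ∸ 1)
    p∣x[x^q∸1] = subst (p ∣_) (sym (*-distribˡ-∸ x (x ^ q) 1))
                   (≈⇒∣∸ (*-monoʳ-≤ x (m^n>0 x q)) (≈-trans (fermat x) (≡⇒≈ (sym (*-identityʳ x)))))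

  P : ℕ → ℕ
  P = powerSum p

  -- If p divides P k for 0 < k ≤ r and r + 2 < p then p ∣ P (r + 1): in
  -- Σ_{k≤r+1} C(r+2,k)·P k = p^(r+2) all terms but the last are divisible by p
  -- (P 0 = p), and the last is (r + 2)·P (r + 1) with p ∤ r + 2.
  powerSum-next : ∀ r → suc (suc r) < p → (∀ k → 0 < k → k ≤ r → p ∣ P k) → p ∣ P (suc r)
  powerSum-next r r+2<p below =
    [ (λ d → ⊥-elim (∤-small z<s r+2<p (subst (p ∣_) (C[1+n,n] (suc r)) d))) , id ]′
      (euclidsLemma _ _ p-prime (∣m+n∣m⇒∣n whole earlier))
    where
    f : ℕ → ℕ
    f k = (suc (suc r) C k) * P k
    whole : p ∣ Σ< (suc r) f + f (suc r)
    whole = subst (p ∣_) (trans (sym (powerSum-recurrence p (suc r))) (Σ<-last (suc r) f)) (m∣m*n (p ^ suc r))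
    earlier : p ∣ Σ< (suc r) f
    earlier = Σ<-∣ (suc r) term
      where
      term : ∀ k → k < suc r → p ∣ f k
      term zero    _   = ∣n⇒∣m*n (suc (suc r) C 0) (subst (p ∣_) (sym (Σ<-ones p)) ∣-refl)
      term (suc k) k<r = ∣n⇒∣m*n (suc (suc r) C suc k) (below (suc k) z<s (s≤s⁻¹ k<r))

  powerSum-vanishes-upto : ∀ r → suc r < p → ∀ k → 0 < k → k ≤ r → p ∣ P k
  powerSum-vanishes-upto zero    _     (suc k) _ ()
  powerSum-vanishes-upto (suc r) r+2<p k 0<k k≤r+1 with m≤n⇒m<n∨m≡n k≤r+1
  ... | inj₁ k<r+1 = powerSum-vanishes-upto r (<-trans (n<1+n _) r+2<p) k 0<k (s≤s⁻¹ k<r+1)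
  ... | inj₂ refl  = powerSum-next r r+2<p (powerSum-vanishes-upto r (<-trans (n<1+n _) r+2<p))

  powerSum-vanishes : ∀ r → 0 < r → r < q → p ∣ P r
  powerSum-vanishes r 0<r r<q = powerSum-vanishes-upto r (s<s r<q) r 0<r ≤-refl

  -- P e ≡ 0 (mod p) whenever q ∤ e, since P e ≡ P (e mod q).
  powerSum-nonmultiple : ∀ e → ¬ q ∣ e → p ∣ P e
  powerSum-nonmultiple e q∤e = ≈0⇒∣ (begin
    P e          ≈⟨ Σ<-cong-≈ p (λ x _ → ≈-trans (≡⇒≈ (cong (x ^_) (m≡m%n+[m/n]*n e q))) (power-periodic (e / q) (e % q) x 0<r)) ⟩
    P (e % q)    ≈⟨ ∣⇒≈0 (powerSum-vanishes (e % q) 0<r (m%n<n e q)) ⟩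
    0            ∎)
    where
    open ≈-Reasoning
    0<r : 0 < e % q
    0<r = n≢0⇒n>0 (q∤e ∘ m%n≡0⇒n∣m e q)

  -- P (c q) ≡ q ≡ -1 (mod p) for c > 0: each unit contributes 1, and 0 nothing.
  powerSum-multiple : ∀ c → 0 < c → P (c * q) ≈ q
  powerSum-multiple (suc c) _ = begin
    P (q + c * q)                     ≈⟨ Σ<-cong-≈ p (λ x _ → power-periodic c q x 0<q) ⟩
    0 ^ q + Σ< q (λ x → suc x ^ q)    ≈⟨ +-cong (≡⇒≈ (zero-power q 0<q)) (Σ<-cong-≈ q (λ x x<q → unit-power (suc x) z<s (s<s x<q))) ⟩
    Σ< q (λ _ → 1)                    ≡⟨ Σ<-ones q ⟩
    q                                 ∎
    where
    open ≈-Reasoning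
    zero-power : ∀ k → 0 < k → 0 ^ k ≡ 0
    zero-power (suc k) _ = refl

  -- For such t, the power
  -- sum P t vanishes, yet its expansion reduces to C(t,l)·a^(t-l)·q ≢ 0.
  no-unique-exponent : ∀ n s a → 0 < n → ¬ p ∣ a → Permutes p (n + s) n a → ¬ UniqueExponent q n s
  no-unique-exponent n s a 0<n p∤a permutes u =
    ∤-* (∤-C j≤t (<-trans t<q (n<1+n q))) (∤-* (∤-^ (t ∸ j) p∤a) (∤-small 0<q (n<1+n q))) (≈0⇒∣ (begin
      (t C j) * (a ^ (t ∸ j) * q)  ≈⟨ *-cong {t C j} ≈-refl (*-cong {a ^ (t ∸ j)} ≈-refl exceptional) ⟨
      term j                       ≈⟨ Σ<-single (suc t) term j (s<s j≤t) others ⟨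
      Σ< (suc t) term              ≡⟨ expand-powerSum p n s a t ⟨
      Σ< p (λ x → (x ^ (n + s) + a * x ^ n) ^ t)
                                   ≈⟨ permutation-powerSum (λ x → x ^ (n + s) + a * x ^ n) permutes t ⟨
      P t                          ≈⟨ ∣⇒≈0 (powerSum-vanishes t 0<t t<q) ⟩
      0                            ∎))
    where
    open ≈-Reasoning
    open UniqueExponent u
    term : ℕ → ℕ
    term l = (t C l) * (a ^ (t ∸ l) * P (n * t + s * l))
    others : ∀ l → l < suc t → l ≢ j → p ∣ term l
    others l l<1+t l≢j = ∣n⇒∣m*n (t C l) (∣n⇒∣m*n (a ^ (t ∸ l)) (powerSum-nonmultiple (n * t + s * l) (l≢j ∘ unique l (s≤s⁻¹ l<1+t))))
    c : ℕ
    c = quotient divides-at-j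
    nt+sj≡cq : n * t + s * j ≡ c * q
    nt+sj≡cq = m∣n⇒n≡quotient*m divides-at-j
    0<c : 0 < c
    0<c = n≢0⇒n>0 λ c≡0 → <⇒≢ (≤-trans (*-mono-< 0<n 0<t) (m≤m+n (n * t) (s * j))) (sym (trans nt+sj≡cq (cong (_* q) c≡0)))
    exceptional : P (n * t + s * j) ≈ q
    exceptional = ≈-trans (≡⇒≈ (cong P nt+sj≡cq)) (powerSum-multiple c 0<c)

permutation-bound : ∀ q → Prime (suc q) → ∀ n s a → 0 < n → 0 < s → ¬ suc q ∣ a →
                    Permutes (suc q) (n + s) n a → q ≤ (n + s ∸ 1) * gcd s q
permutation-bound q p-prime n s a 0<n 0<s p∤a permutes = ≮⇒≥ λ small →
  PrimeField.no-unique-exponent q p-prime n s a 0<n p∤a permutes (ExponentSearch.uniqueExponent q n s 0<n 0<s small)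

theorem1p2 : (p : ℕ) .{{_ : NonZero p}} → Prime p → (m n a : ℕ) → 0 < n → n < m →
    1 ≤ a → a < p → Permutes p m n a →
    p ∸ 1 ≤ (m ∸ 1) * (n ⊔ gcd (m ∸ n) (p ∸ 1))
theorem1p2 zero    p-prime _ _ _ _ _ _ _ _ = ⊥-elim (¬prime[0] p-prime)
theorem1p2 (suc q) p-prime m n a 0<n n<m 1≤a a<p permutes = begin
  q                              ≤⟨ permutation-bound q p-prime n s a 0<n (m<n⇒0<n∸m n<m) p∤a permutes′ ⟩
  (n + s ∸ 1) * gcd s q          ≡⟨ cong (λ k → (k ∸ 1) * gcd s q) n+s≡m ⟩
  (m ∸ 1) * gcd s q              ≤⟨ *-monoʳ-≤ (m ∸ 1) (m≤n⊔m n (gcd s q)) ⟩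
  (m ∸ 1) * (n ⊔ gcd s q)        ∎
  where
  open ≤-Reasoning
  s : ℕ
  s = m ∸ n
  n+s≡m : n + s ≡ m
  n+s≡m = m+[n∸m]≡n (<⇒≤ n<m)
  permutes′ : Permutes (suc q) (n + s) n a
  permutes′ = subst (λ k → Permutes (suc q) k n a) (sym n+s≡m) permutes
  p∤a : ¬ suc q ∣ a
  p∤a = PrimeField.∤-small q p-prime 1≤a a<p
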